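{- Let $G$ be a graph with $X,Y\subseteq V(G)$ and let $l$ be an intersecting supermodular real function on subsets of $V(G)$. If $G[X]$ and $G[Y]$ are $l$-partition-connected and $X\cap Y\neq\emptyset$, then $G[X\cup Y]$ is also $l$-partition-connected.
   Context: Graphs are finite, loopless, and may have multiple edges. $l(\emptyset)=0$. $l$ is intersecting supermodular if $l(A\cap B)+l(A\cup B)\ge l(A)+l(B)$ whenever $A\cap B\neq\emptyset$. $G[X]$ is the induced subgraph on $X$. For a partition $P$ of $V(K)$, $e_K(P)$ is the number of edges of $K$ joining different parts; $K$ is $l$-partition-connected if $e_K(P)\ge\sum_{A\in P}l(A)-l(V(K))$ for every partition $P$ of $V(K)$. -}

module Defs where

open import Level using (Level; _⊔_; suc)
open import Data.Nat using (ℕ; zero) renaming (suc to sucℕ)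
open import Data.Bool using (Bool; true; false; _∧_; not)
open import Data.Fin using (Fin)
open import Data.Fin.Subset using (Subset; _∩_; _∪_; ⋃; Nonempty; Empty) renaming (⊥ to ∅)
open import Data.Vec using (lookup)
open import Data.List using (List; []; _∷_; foldr)
open import Data.Bool.ListAction using (any)
open import Data.List.Relation.Unary.All using (All)
open import Data.List.Relation.Unary.AllPairs using (AllPairs)
open import Data.Product using (_×_; _,_; proj₁; proj₂)
open import Relation.Binary.PropositionalEquality using (_≡_; _≢_)
open import Relation.Binary.Core using (Rel)
open import Relation.Binary.Structures using (IsTotalOrder)
open import Algebra.Bundles using (CommutativeRing)

-- Totally ordered commutative rings (ℝ is an instance).  The values of
-- the set function l live in such a ring; only its additive ordered
-- structure and the copy of ℕ (via 1#) are used.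

record OrderedCommutativeRing (c ℓ₁ ℓ₂ : Level) : Set (suc (c ⊔ ℓ₁ ⊔ ℓ₂)) where
  field
    commutativeRing : CommutativeRing c ℓ₁
  open CommutativeRing commutativeRing public
  field
    _≤_          : Rel Carrier ℓ₂
    isTotalOrder : IsTotalOrder _≈_ _≤_
    +-monoˡ-≤    : ∀ {x y} z → x ≤ y → (x + z) ≤ (y + z)
    *-nonneg     : ∀ {x y} → 0# ≤ x → 0# ≤ y → 0# ≤ (x * y)
    0≤1          : 0# ≤ 1#

-- Graphs on vertex set Fin n: loopless multigraphs given by an edge list
-- (repeated entries = parallel edges).

record Graph (n : ℕ) : Set where
  field
    edges    : List (Fin n × Fin n)
    loopless : All (λ e → proj₁ e ≢ proj₂ e) edges
open Graph public

_∈ᵇ_ : ∀ {n} → Fin n → Subset n → Bool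
v ∈ᵇ A = lookup A v

IsPartition : ∀ {n} → Subset n → List (Subset n) → Set
IsPartition X P = All Nonempty P × AllPairs (λ A B → Empty (A ∩ B)) P × ⋃ P ≡ X

sameBlock : ∀ {n} → List (Subset n) → Fin n → Fin n → Bool
sameBlock P u v = any (λ A → (u ∈ᵇ A) ∧ (v ∈ᵇ A)) P

crossingEdges : ∀ {n} → Graph n → Subset n → List (Subset n) → ℕ
crossingEdges G X P = go (edges G)
  where
  count : Bool → ℕ → ℕ
  count true  k = sucℕ k
  count false k = k
  go : List _ → ℕ
  go [] = zero
  go ((u , v) ∷ es) =
    count ((u ∈ᵇ X) ∧ (v ∈ᵇ X) ∧ not (sameBlock P u v)) (go es)

module _ {c ℓ₁ ℓ₂} (R : OrderedCommutativeRing c ℓ₁ ℓ₂) where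
  open OrderedCommutativeRing R

  fromℕ : ℕ → Carrier
  fromℕ zero      = 0#
  fromℕ (sucℕ k)  = 1# + fromℕ k

  IntersectingSupermodular : ∀ {n} → (Subset n → Carrier) → Set (ℓ₁ ⊔ ℓ₂)
  IntersectingSupermodular {n} l =
    (l ∅ ≈ 0#) ×
    (∀ (A B : Subset n) → Nonempty (A ∩ B) →
       (l A + l B) ≤ (l (A ∩ B) + l (A ∪ B)))

  sumOver : ∀ {n} → (Subset n → Carrier) → List (Subset n) → Carrier
  sumOver l = foldr (λ A s → l A + s) 0#

  PartitionConnected : ∀ {n} → Graph n → (Subset n → Carrier) → Subset n → Set (ℓ₂)
  PartitionConnected G l X =
    ∀ (P : List (Subset _)) → IsPartition X P →
      (sumOver l P - l X) ≤ fromℕ (crossingEdges G X P)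

-- Split a partition P of X ∪ Y into the parts P₁ meeting X and the parts P₂ avoiding X.
-- The traces on X of the parts in P₁ partition X; the set W = X ∪ ⋃ P₁, cut down to Y,
-- together with P₂ partitions Y. Uncrossing X with the parts of P₁ one at a time
-- (intersecting supermodularity; the parts are disjoint, so each meets the growing set
-- only inside X) gives Σ_{P₁} l + l(X) ≤ Σ_{A ∈ P₁} l(A ∩ X) + l(W), and since W and Y
-- meet, l(W) + l(Y) ≤ l(W ∩ Y) + l(X ∪ Y). Adding the partition-connectivity bounds
-- for X and Y then bounds Σ_P l − l(X ∪ Y) by the number of edges crossing either of
-- the two partitions, and such an edge crosses P but cannot cross both.

module Submission where

open import Defs
open import Level using (Level)
open import Data.Nat using (ℕ)
open import Data.Fin.Subset using (Subset; _∩_; _∪_; Nonempty)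

open import Data.Bool using (Bool; true; false; T; _∧_; not)
open import Data.Bool.Properties using (T-≡; T-∧; T-not-≡)
open import Data.Empty using (⊥; ⊥-elim)
open import Data.Fin using (Fin)
open import Data.Fin.Subset using (_∈_; _⊆_; ⋃; Empty) renaming (⊥ to ∅)
open import Data.Fin.Subset.Properties
  using (x∈p∩q⁺; x∈p∩q⁻; x∈p∪q⁺; x∈p∪q⁻; p⊆p∪q; q⊆p∪q; p∩q⊆p; p∩q⊆q; ∉⊥; ⊆-refl; ⊆-antisym; nonempty?;
         Empty-unique; ∩-distribˡ-∪; ∪-identityʳ; ∪-commutativeMonoid)
open import Data.List using (List; []; _∷_; map; filter; filterᵇ; length)
open import Data.List.Membership.Propositional using (find; lose) renaming (_∈_ to _∈ₗ_)
open import Data.List.Membership.Propositional.Properties using (∈-filter⁺; ∈-filter⁻; ∈-map⁺; ∈-map⁻)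
open import Data.List.Relation.Unary.Any using (here; there)
open import Data.List.Relation.Unary.Any.Properties using (any⇔)
open import Data.List.Relation.Unary.All as All using (All; []; _∷_)
open import Data.List.Relation.Unary.All.Properties using (all-filter) renaming (map⁺ to All-map⁺; filter⁺ to All-filter⁺)
open import Data.List.Relation.Unary.AllPairs as AllPairs using (AllPairs; []; _∷_)
import Data.List.Relation.Unary.AllPairs.Properties as AllPairsₚ
open import Algebra.Bundles using (CommutativeMonoid)
import Algebra.Properties.CommutativeSemigroup
import Algebra.Properties.Group
import Data.Nat as ℕ
import Data.Nat.Properties as ℕₚ
open import Data.Maybe using (nothing)
open import Data.Product using (_×_; _,_; proj₁; ∃)
open import Data.Sum using (inj₁; inj₂)
open import Data.Vec.Properties using ([]=⇒lookup; lookup⇒[]=)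
open import Function using (_∘_; _⇔_; mk⇔; Equivalence)
open import Relation.Binary.Bundles using (Poset)
open import Relation.Binary.Structures using (IsTotalOrder)
open import Relation.Binary.PropositionalEquality using (_≡_; _≢_; refl; sym; cong; cong₂; subst)
import Relation.Binary.PropositionalEquality as ≡
open import Relation.Nullary using (¬_; yes; no; ¬?)
open import Relation.Unary using (Decidable)
import Relation.Binary.Reasoning.PartialOrder as PosetReasoning
open import Tactic.RingSolver using (solve-∀)
open import Tactic.RingSolver.Core.AlmostCommutativeRing using (AlmostCommutativeRing; fromCommutativeRing)

module _ {n : ℕ} where

  Disjoint : Subset n → Subset n → Set
  Disjoint A B = Empty (A ∩ B)

  PairwiseDisjoint : List (Subset n) → Set
  PairwiseDisjoint = AllPairs Disjoint

  disjoint-∉ : ∀ {A B x} → Disjoint A B → x ∈ A → x ∈ B → ⊥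
  disjoint-∉ {x = x} A#B x∈A x∈B = A#B (x , x∈p∩q⁺ (x∈A , x∈B))

  disjoint-sym : ∀ {A B} → Disjoint A B → Disjoint B A
  disjoint-sym A#B (x , x∈B∩A) with x∈p∩q⁻ _ _ x∈B∩A
  ... | x∈B , x∈A = disjoint-∉ A#B x∈A x∈B

  disjoint-mono : ∀ {A B C D} → C ⊆ A → D ⊆ B → Disjoint A B → Disjoint C D
  disjoint-mono C⊆A D⊆B A#B (x , x∈C∩D) with x∈p∩q⁻ _ _ x∈C∩D
  ... | x∈C , x∈D = disjoint-∉ A#B (C⊆A x∈C) (D⊆B x∈D)

  x∈⋃⁺ : ∀ {x A} (L : List (Subset n)) → A ∈ₗ L → x ∈ A → x ∈ ⋃ L
  x∈⋃⁺ (A ∷ L) (here refl) x∈A = x∈p∪q⁺ (inj₁ x∈A)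
  x∈⋃⁺ (B ∷ L) (there A∈L) x∈A = x∈p∪q⁺ (inj₂ (x∈⋃⁺ L A∈L x∈A))

  x∈⋃⁻ : ∀ {x} (L : List (Subset n)) → x ∈ ⋃ L → ∃ λ A → A ∈ₗ L × x ∈ A
  x∈⋃⁻ [] x∈∅ = ⊥-elim (∉⊥ x∈∅)
  x∈⋃⁻ (A ∷ L) x∈A∪⋃L with x∈p∪q⁻ A (⋃ L) x∈A∪⋃L
  ... | inj₁ x∈A = A , here refl , x∈A
  ... | inj₂ x∈⋃L with x∈⋃⁻ L x∈⋃L
  ...   | B , B∈L , x∈B = B , there B∈L , x∈B

  disjoint-⋃ : ∀ {A} (L : List (Subset n)) → All (Disjoint A) L → Disjoint A (⋃ L)
  disjoint-⋃ L A#L (x , x∈A∩⋃L) with x∈p∩q⁻ _ (⋃ L) x∈A∩⋃L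
  ... | x∈A , x∈⋃L with x∈⋃⁻ L x∈⋃L
  ...   | B , B∈L , x∈B = disjoint-∉ (All.lookup A#L B∈L) x∈A x∈B

  pairwiseDisjoint-∈ : ∀ {L A B} → PairwiseDisjoint L → A ∈ₗ L → B ∈ₗ L → A ≢ B → Disjoint A B
  pairwiseDisjoint-∈ (_ ∷ _)       (here refl)  (here refl)  A≢B = ⊥-elim (A≢B refl)
  pairwiseDisjoint-∈ (A#L ∷ _)     (here refl)  (there B∈L)  _   = All.lookup A#L B∈L
  pairwiseDisjoint-∈ (B#L ∷ _)     (there A∈L)  (here refl)  _   = disjoint-sym (All.lookup B#L A∈L)
  pairwiseDisjoint-∈ (_ ∷ L-disj)  (there A∈L)  (there B∈L)  A≢B = pairwiseDisjoint-∈ L-disj A∈L B∈L A≢B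

  disjoint⇒∩-∪-absorb : ∀ {A B} X → Disjoint A B → A ∩ (X ∪ B) ≡ A ∩ X
  disjoint⇒∩-∪-absorb {A} {B} X A#B = begin
    A ∩ (X ∪ B)        ≡⟨ ∩-distribˡ-∪ A X B ⟩
    (A ∩ X) ∪ (A ∩ B)  ≡⟨ cong ((A ∩ X) ∪_) (Empty-unique A#B) ⟩
    (A ∩ X) ∪ ∅        ≡⟨ ∪-identityʳ (A ∩ X) ⟩
    A ∩ X              ∎
    where open ≡.≡-Reasoning

  open Algebra.Properties.CommutativeSemigroup (CommutativeMonoid.commutativeSemigroup (∪-commutativeMonoid n))
    public using () renaming (x∙yz≈y∙xz to ∪-leftComm)

  isPartition-⊆ : ∀ {Z P A} → IsPartition Z P → A ∈ₗ P → A ⊆ Z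
  isPartition-⊆ {P = P} (_ , _ , ⋃P≡Z) A∈P {x} x∈A = subst (x ∈_) ⋃P≡Z (x∈⋃⁺ P A∈P x∈A)

  isPartition-cover : ∀ {Z P x} → IsPartition Z P → x ∈ Z → ∃ λ A → A ∈ₗ P × x ∈ A
  isPartition-cover {P = P} {x} (_ , _ , ⋃P≡Z) x∈Z = x∈⋃⁻ P (subst (x ∈_) (sym ⋃P≡Z) x∈Z)

  Meets : Subset n → Subset n → Set
  Meets X A = Nonempty (A ∩ X)

  meets? : ∀ X → Decidable (Meets X)
  meets? X A = nonempty? (A ∩ X)

  avoids? : ∀ X → Decidable (¬_ ∘ Meets X)
  avoids? X = ¬? ∘ meets? X

  restrict : Subset n → List (Subset n) → List (Subset n)
  restrict X P = map (_∩ X) (filter (meets? X) P)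

  restrict-isPartition : ∀ {Z X P} → X ⊆ Z → IsPartition Z P → IsPartition X (restrict X P)
  restrict-isPartition {X = X} {P} X⊆Z P-part@(_ , P-disjoint , _) =
    All-map⁺ (all-filter (meets? X) P) ,
    AllPairsₚ.map⁺ (AllPairs.map (λ {A} {B} → disjoint-mono (p∩q⊆p A X) (p∩q⊆p B X))
                                 (AllPairsₚ.filter⁺ (meets? X) P-disjoint)) ,
    ⊆-antisym ⋃⊆X X⊆⋃
    where
    ⋃⊆X : ⋃ (restrict X P) ⊆ X
    ⋃⊆X x∈⋃ with x∈⋃⁻ (restrict X P) x∈⋃
    ... | _ , A∩X∈restrict , x∈A∩X with ∈-map⁻ (_∩ X) A∩X∈restrict
    ...   | A , _ , refl = p∩q⊆q A X x∈A∩X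
    X⊆⋃ : X ⊆ ⋃ (restrict X P)
    X⊆⋃ {x} x∈X with isPartition-cover P-part (X⊆Z x∈X)
    ... | A , A∈P , x∈A = x∈⋃⁺ (restrict X P) (∈-map⁺ (_∩ X) (∈-filter⁺ (meets? X) A∈P (x , x∈A∩X))) x∈A∩X
      where
      x∈A∩X : x ∈ A ∩ X
      x∈A∩X = x∈p∩q⁺ (x∈A , x∈X)

  merged : Subset n → List (Subset n) → Subset n
  merged X P = X ∪ ⋃ (filter (meets? X) P)

  fuse : Subset n → Subset n → List (Subset n) → List (Subset n)
  fuse X Y P = merged X P ∩ Y ∷ filter (avoids? X) P

  avoiding-disjoint-merged : ∀ {X P B} → PairwiseDisjoint P → B ∈ₗ filter (avoids? X) P → Disjoint B (merged X P)
  avoiding-disjoint-merged {X} {P} {B} P-disjoint B∈ (x , x∈B∩W) with ∈-filter⁻ (avoids? X) B∈ | x∈p∩q⁻ B _ x∈B∩W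
  ... | B∈P , B∌X | x∈B , x∈W with x∈p∪q⁻ X _ x∈W
  ...   | inj₁ x∈X = B∌X (x , x∈p∩q⁺ (x∈B , x∈X))
  ...   | inj₂ x∈⋃ with x∈⋃⁻ (filter (meets? X) P) x∈⋃
  ...     | A , A∈ , x∈A with ∈-filter⁻ (meets? X) A∈
  ...       | A∈P , A-meets = disjoint-∉ (pairwiseDisjoint-∈ P-disjoint A∈P B∈P A≢B) x∈A x∈B
    where
    A≢B : A ≢ B
    A≢B refl = B∌X A-meets

  merged-∪ : ∀ {X Y P} → IsPartition (X ∪ Y) P → merged X P ∪ Y ≡ X ∪ Y
  merged-∪ {X} {Y} {P} P-part = ⊆-antisym W∪Y⊆X∪Y X∪Y⊆W∪Y
    where
    W∪Y⊆X∪Y : merged X P ∪ Y ⊆ X ∪ Y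
    W∪Y⊆X∪Y x∈W∪Y with x∈p∪q⁻ (merged X P) Y x∈W∪Y
    ... | inj₂ x∈Y = q⊆p∪q X Y x∈Y
    ... | inj₁ x∈W with x∈p∪q⁻ X _ x∈W
    ...   | inj₁ x∈X = p⊆p∪q Y x∈X
    ...   | inj₂ x∈⋃ with x∈⋃⁻ (filter (meets? X) P) x∈⋃
    ...     | A , A∈ , x∈A = isPartition-⊆ P-part (proj₁ (∈-filter⁻ (meets? X) A∈)) x∈A
    X∪Y⊆W∪Y : X ∪ Y ⊆ merged X P ∪ Y
    X∪Y⊆W∪Y x∈X∪Y with x∈p∪q⁻ X Y x∈X∪Y
    ... | inj₁ x∈X = p⊆p∪q Y (p⊆p∪q _ x∈X)
    ... | inj₂ x∈Y = q⊆p∪q (merged X P) Y x∈Y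

  fuse-isPartition : ∀ {X Y P} → Nonempty (X ∩ Y) → IsPartition (X ∪ Y) P → IsPartition Y (fuse X Y P)
  fuse-isPartition {X} {Y} {P} (x , x∈X∩Y) P-part@(P-nonempty , P-disjoint , _) =
    ((x , X∩Y⊆W∩Y x∈X∩Y) ∷ All-filter⁺ (avoids? X) P-nonempty) ,
    (All.tabulate (λ B∈ → disjoint-mono (p∩q⊆p _ Y) ⊆-refl (disjoint-sym (avoiding-disjoint-merged P-disjoint B∈)))
      ∷ AllPairsₚ.filter⁺ (avoids? X) P-disjoint) ,
    ⊆-antisym ⋃⊆Y Y⊆⋃
    where
    X∩Y⊆W∩Y : X ∩ Y ⊆ merged X P ∩ Y
    X∩Y⊆W∩Y x∈X∩Y with x∈p∩q⁻ X Y x∈X∩Y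
    ... | x∈X , x∈Y = x∈p∩q⁺ (p⊆p∪q _ x∈X , x∈Y)
    ⋃⊆Y : ⋃ (fuse X Y P) ⊆ Y
    ⋃⊆Y x∈⋃ with x∈p∪q⁻ (merged X P ∩ Y) _ x∈⋃
    ... | inj₁ x∈W∩Y = p∩q⊆q _ Y x∈W∩Y
    ... | inj₂ x∈⋃B with x∈⋃⁻ (filter (avoids? X) P) x∈⋃B
    ...   | B , B∈ , x∈B with ∈-filter⁻ (avoids? X) B∈
    ...     | B∈P , B∌X with x∈p∪q⁻ X Y (isPartition-⊆ P-part B∈P x∈B)
    ...       | inj₁ x∈X = ⊥-elim (B∌X (_ , x∈p∩q⁺ (x∈B , x∈X)))
    ...       | inj₂ x∈Y = x∈Y
    Y⊆⋃ : Y ⊆ ⋃ (fuse X Y P)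
    Y⊆⋃ {y} y∈Y with isPartition-cover P-part (q⊆p∪q X Y y∈Y)
    ... | A , A∈P , y∈A with meets? X A
    ...   | yes A-meets = p⊆p∪q _ (x∈p∩q⁺ (q⊆p∪q X _ (x∈⋃⁺ (filter (meets? X) P) (∈-filter⁺ (meets? X) A∈P A-meets) y∈A) , y∈Y))
    ...   | no A∌X = q⊆p∪q _ _ (x∈⋃⁺ (filter (avoids? X) P) (∈-filter⁺ (avoids? X) A∈P A∌X) y∈A)

  ∈ᵇ⇔∈ : ∀ {x : Fin n} {A} → T (x ∈ᵇ A) ⇔ x ∈ A
  ∈ᵇ⇔∈ {x} {A} = mk⇔ (lookup⇒[]= x A ∘ Equivalence.to T-≡) (Equivalence.from T-≡ ∘ []=⇒lookup)

  SameBlock : List (Subset n) → Fin n → Fin n → Set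
  SameBlock P u v = ∃ λ A → A ∈ₗ P × u ∈ A × v ∈ A

  sameBlock⇔SameBlock : ∀ {P u v} → T (sameBlock P u v) ⇔ SameBlock P u v
  sameBlock⇔SameBlock {P} {u} {v} = mk⇔ to from
    where
    to : T (sameBlock P u v) → SameBlock P u v
    to t with find (Equivalence.from any⇔ t)
    ... | A , A∈P , u∈A∧v∈A with Equivalence.to T-∧ u∈A∧v∈A
    ...   | u∈A , v∈A = A , A∈P , Equivalence.to ∈ᵇ⇔∈ u∈A , Equivalence.to ∈ᵇ⇔∈ v∈A
    from : SameBlock P u v → T (sameBlock P u v)
    from (A , A∈P , u∈A , v∈A) =
      Equivalence.to any⇔ (lose A∈P (Equivalence.from T-∧ (Equivalence.from ∈ᵇ⇔∈ u∈A , Equivalence.from ∈ᵇ⇔∈ v∈A)))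

  Crosses : Subset n → List (Subset n) → Fin n × Fin n → Set
  Crosses X P (u , v) = u ∈ X × v ∈ X × ¬ SameBlock P u v

  crosses : Subset n → List (Subset n) → Fin n × Fin n → Bool
  crosses X P (u , v) = (u ∈ᵇ X) ∧ (v ∈ᵇ X) ∧ not (sameBlock P u v)

  crosses⇔Crosses : ∀ {X P} e → T (crosses X P e) ⇔ Crosses X P e
  crosses⇔Crosses {X} {P} (u , v) = mk⇔ to from
    where
    to : T (crosses X P (u , v)) → Crosses X P (u , v)
    to t with Equivalence.to T-∧ t
    ... | u∈X , t₂ with Equivalence.to T-∧ t₂
    ...   | v∈X , not-sb =
      Equivalence.to ∈ᵇ⇔∈ u∈X , Equivalence.to ∈ᵇ⇔∈ v∈X ,
      λ sb → subst T (Equivalence.to T-not-≡ not-sb) (Equivalence.from sameBlock⇔SameBlock sb)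
    from : Crosses X P (u , v) → T (crosses X P (u , v))
    from (u∈X , v∈X , ¬sb) =
      Equivalence.from T-∧ (Equivalence.from ∈ᵇ⇔∈ u∈X ,
        Equivalence.from T-∧ (Equivalence.from ∈ᵇ⇔∈ v∈X , Equivalence.from T-not-≡ (¬T⇒≡false (¬sb ∘ Equivalence.to sameBlock⇔SameBlock))))
      where
      ¬T⇒≡false : ∀ {b} → ¬ T b → b ≡ false
      ¬T⇒≡false {true}  ¬T = ⊥-elim (¬T _)
      ¬T⇒≡false {false} _  = refl

  sameBlock-restrict : ∀ {X P u v} → u ∈ X → v ∈ X → SameBlock P u v → SameBlock (restrict X P) u v
  sameBlock-restrict {X} {P} {u} u∈X v∈X (A , A∈P , u∈A , v∈A) =
    A ∩ X , ∈-map⁺ (_∩ X) (∈-filter⁺ (meets? X) A∈P (u , u∈A∩X)) , u∈A∩X , x∈p∩q⁺ (v∈A , v∈X)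
    where
    u∈A∩X : u ∈ A ∩ X
    u∈A∩X = x∈p∩q⁺ (u∈A , u∈X)

  sameBlock-fuse : ∀ {X Y P u v} → u ∈ Y → v ∈ Y → SameBlock P u v → SameBlock (fuse X Y P) u v
  sameBlock-fuse {X} {Y} {P} u∈Y v∈Y (A , A∈P , u∈A , v∈A) with meets? X A
  ... | yes A-meets = merged X P ∩ Y , here refl , x∈p∩q⁺ (A⊆W u∈A , u∈Y) , x∈p∩q⁺ (A⊆W v∈A , v∈Y)
    where
    A⊆W : A ⊆ merged X P
    A⊆W x∈A = q⊆p∪q X _ (x∈⋃⁺ (filter (meets? X) P) (∈-filter⁺ (meets? X) A∈P A-meets) x∈A)
  ... | no A∌X = A , there (∈-filter⁺ (avoids? X) A∈P A∌X) , u∈A , v∈A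

  restrict-crosses : ∀ {Z X P} → X ⊆ Z → ∀ {e} → Crosses X (restrict X P) e → Crosses Z P e
  restrict-crosses X⊆Z (u∈X , v∈X , ¬sb) = X⊆Z u∈X , X⊆Z v∈X , ¬sb ∘ sameBlock-restrict u∈X v∈X

  fuse-crosses : ∀ {X Y P e} → Crosses Y (fuse X Y P) e → Crosses (X ∪ Y) P e
  fuse-crosses {X} {Y} (u∈Y , v∈Y , ¬sb) = q⊆p∪q X Y u∈Y , q⊆p∪q X Y v∈Y , ¬sb ∘ sameBlock-fuse u∈Y v∈Y

  restrict-fuse-¬crosses : ∀ {X Y P e} → Crosses X (restrict X P) e → Crosses Y (fuse X Y P) e → ⊥
  restrict-fuse-¬crosses {X} {Y} {P} (u∈X , v∈X , _) (u∈Y , v∈Y , ¬sb) =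
    ¬sb (merged X P ∩ Y , here refl , x∈p∩q⁺ (p⊆p∪q _ u∈X , u∈Y) , x∈p∩q⁺ (p⊆p∪q _ v∈X , v∈Y))

length-filterᵇ-+-≤ : ∀ {a} {A : Set a} (p q r : A → Bool) →
  (∀ {x} → T (p x) → T (r x)) → (∀ {x} → T (q x) → T (r x)) → (∀ {x} → T (p x) → T (q x) → ⊥) →
  ∀ xs → length (filterᵇ p xs) ℕ.+ length (filterᵇ q xs) ℕ.≤ length (filterᵇ r xs)
length-filterᵇ-+-≤ p q r p⇒r q⇒r p∧q⇒⊥ [] = ℕ.z≤n
length-filterᵇ-+-≤ p q r p⇒r q⇒r p∧q⇒⊥ (x ∷ xs)
  with p x | q x | r x | p⇒r {x} | q⇒r {x} | p∧q⇒⊥ {x} | length-filterᵇ-+-≤ p q r p⇒r q⇒r p∧q⇒⊥ xs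
... | true  | true  | _     | _   | _   | p∧q⇒⊥ₓ | _  = ⊥-elim (p∧q⇒⊥ₓ _ _)
... | true  | false | false | p⇒rₓ | _   | _      | _  = ⊥-elim (p⇒rₓ _)
... | false | true  | false | _   | q⇒rₓ | _      | _  = ⊥-elim (q⇒rₓ _)
... | true  | false | true  | _   | _   | _      | ih = ℕ.s≤s ih
... | false | true  | true  | _   | _   | _      | ih rewrite ℕₚ.+-suc (length (filterᵇ p xs)) (length (filterᵇ q xs)) = ℕ.s≤s ih
... | false | false | true  | _   | _   | _      | ih = ℕₚ.m≤n⇒m≤1+n ih
... | false | false | false | _   | _   | _      | ih = ih

crossingEdges≡length : ∀ {n} (G : Graph n) X P → crossingEdges G X P ≡ length (filterᵇ (crosses X P) (edges G))
crossingEdges≡length G X P = go (edges G) (loopless G)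
  where
  go : ∀ es lps → crossingEdges (record { edges = es ; loopless = lps }) X P ≡ length (filterᵇ (crosses X P) es)
  go [] [] = refl
  go ((u , v) ∷ es) (_ ∷ lps) with crosses X P (u , v)
  ... | true  = cong ℕ.suc (go es lps)
  ... | false = go es lps

crossingEdges-+-≤ : ∀ {n} (G : Graph n) {X₁ X₂ X : Subset n} {P₁ P₂ P : List (Subset n)} →
  (∀ {e} → Crosses X₁ P₁ e → Crosses X P e) → (∀ {e} → Crosses X₂ P₂ e → Crosses X P e) →
  (∀ {e} → Crosses X₁ P₁ e → Crosses X₂ P₂ e → ⊥) →
  crossingEdges G X₁ P₁ ℕ.+ crossingEdges G X₂ P₂ ℕ.≤ crossingEdges G X P
crossingEdges-+-≤ G {X₁} {X₂} {X} {P₁} {P₂} {P} 1⇒ 2⇒ 1∧2⇒⊥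
  rewrite crossingEdges≡length G X₁ P₁ | crossingEdges≡length G X₂ P₂ | crossingEdges≡length G X P =
  length-filterᵇ-+-≤ (crosses X₁ P₁) (crosses X₂ P₂) (crosses X P)
    (λ {e} → from e ∘ 1⇒ ∘ to e) (λ {e} → from e ∘ 2⇒ ∘ to e) (λ {e} c₁ c₂ → 1∧2⇒⊥ (to e c₁) (to e c₂))
    (edges G)
  where
  to : ∀ {Y Q} e → T (crosses Y Q e) → Crosses Y Q e
  to e = Equivalence.to (crosses⇔Crosses e)
  from : ∀ {Y Q} e → Crosses Y Q e → T (crosses Y Q e)
  from e = Equivalence.from (crosses⇔Crosses e)

module OrderedCommutativeRingProperties {c ℓ₁ ℓ₂} (R : OrderedCommutativeRing c ℓ₁ ℓ₂) where

  open OrderedCommutativeRing R using (commutativeRing; +-commutativeSemigroup; +-group; _≤_; isTotalOrder; +-monoˡ-≤; 0≤1)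
  open IsTotalOrder isTotalOrder using () renaming (refl to ≤-refl)
  open Algebra.Properties.CommutativeSemigroup +-commutativeSemigroup using (x∙yz≈xz∙y; xy∙z≈xz∙y; x∙yz≈y∙xz)
  open Algebra.Properties.Group +-group using (//-rightDividesˡ; //-rightDividesʳ)

  private
    acr : AlmostCommutativeRing c ℓ₁
    acr = fromCommutativeRing commutativeRing (λ _ → nothing)

  open AlmostCommutativeRing acr using (Carrier; _≈_; _+_; _-_; -_; 0#; 1#; +-comm; +-assoc; +-cong; +-identityˡ; +-identityʳ)
    renaming (refl to ≈-refl; sym to ≈-sym; trans to ≈-trans)

  poset : Poset c ℓ₁ ℓ₂
  poset = record { isPartialOrder = IsTotalOrder.isPartialOrder isTotalOrder }

  open PosetReasoning poset

  +-mono-≤ : ∀ {x y u v} → x ≤ y → u ≤ v → (x + u) ≤ (y + v)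
  +-mono-≤ {x} {y} {u} {v} x≤y u≤v = begin
    x + u  ≤⟨ +-monoˡ-≤ u x≤y ⟩
    y + u  ≈⟨ +-comm y u ⟩
    u + y  ≤⟨ +-monoˡ-≤ y u≤v ⟩
    v + y  ≈⟨ +-comm v y ⟩
    y + v  ∎

  +-cancelʳ-≤ : ∀ {x y} k → (x + k) ≤ (y + k) → x ≤ y
  +-cancelʳ-≤ {x} {y} k x+k≤y+k = begin
    x            ≈⟨ ≈-sym (//-rightDividesʳ k x) ⟩
    (x + k) - k  ≤⟨ +-monoˡ-≤ (- k) x+k≤y+k ⟩
    (y + k) - k  ≈⟨ //-rightDividesʳ k y ⟩
    y            ∎

  x-y≤z⇒x≤z+y : ∀ {x y z} → (x - y) ≤ z → x ≤ (z + y)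
  x-y≤z⇒x≤z+y {x} {y} {z} x-y≤z = begin
    x            ≈⟨ ≈-sym (//-rightDividesˡ y x) ⟩
    (x - y) + y  ≤⟨ +-monoˡ-≤ y x-y≤z ⟩
    z + y        ∎

  x≤z+y⇒x-y≤z : ∀ {x y z} → x ≤ (z + y) → (x - y) ≤ z
  x≤z+y⇒x-y≤z {x} {y} {z} x≤z+y = begin
    x - y        ≤⟨ +-monoˡ-≤ (- y) x≤z+y ⟩
    (z + y) - y  ≈⟨ //-rightDividesʳ y z ⟩
    z            ∎

  fromℕ-+ : ∀ m n → fromℕ R (m ℕ.+ n) ≈ fromℕ R m + fromℕ R n
  fromℕ-+ ℕ.zero    n = ≈-sym (+-identityˡ (fromℕ R n))
  fromℕ-+ (ℕ.suc m) n = ≈-trans (+-cong ≈-refl (fromℕ-+ m n)) (≈-sym (+-assoc 1# (fromℕ R m) (fromℕ R n)))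

  fromℕ-mono-≤ : ∀ {m n} → m ℕ.≤ n → fromℕ R m ≤ fromℕ R n
  fromℕ-mono-≤ {m} m≤n with ℕₚ.m≤n⇒∃[o]m+o≡n m≤n
  ... | k , refl = begin
    fromℕ R m                ≈⟨ ≈-sym (+-identityʳ (fromℕ R m)) ⟩
    fromℕ R m + 0#           ≤⟨ +-mono-≤ ≤-refl (fromℕ-nonneg k) ⟩
    fromℕ R m + fromℕ R k    ≈⟨ ≈-sym (fromℕ-+ m k) ⟩
    fromℕ R (m ℕ.+ k)        ∎
    where
    fromℕ-nonneg : ∀ k → 0# ≤ fromℕ R k
    fromℕ-nonneg ℕ.zero    = ≤-refl
    fromℕ-nonneg (ℕ.suc k) = begin
      0#                ≈⟨ ≈-sym (+-identityˡ 0#) ⟩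
      0# + 0#           ≤⟨ +-mono-≤ 0≤1 (fromℕ-nonneg k) ⟩
      1# + fromℕ R k    ∎

  sumOver-filter : ∀ {n} {Q : Subset n → Set} (Q? : Decidable Q) (l : Subset n → Carrier) L →
    sumOver R l L ≈ sumOver R l (filter Q? L) + sumOver R l (filter (¬? ∘ Q?) L)
  sumOver-filter Q? l [] = ≈-sym (+-identityʳ 0#)
  sumOver-filter Q? l (A ∷ L) with Q? A
  ... | yes _ = ≈-trans (+-cong ≈-refl (sumOver-filter Q? l L)) (≈-sym (+-assoc _ _ _))
  ... | no  _ = ≈-trans (+-cong ≈-refl (sumOver-filter Q? l L)) (x∙yz≈y∙xz _ _ _)

  supermodular-uncross : ∀ {n} {l : Subset n → Carrier} → IntersectingSupermodular R l →
    ∀ X L → PairwiseDisjoint L → All (Meets X) L →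
    (sumOver R l L + l X) ≤ (sumOver R l (map (_∩ X) L) + l (X ∪ ⋃ L))
  supermodular-uncross {l = l} _ X [] [] [] = begin
    0# + l X        ≡⟨ cong (λ Z → 0# + l Z) (sym (∪-identityʳ X)) ⟩
    0# + l (X ∪ ∅)  ∎
  supermodular-uncross {l = l} l-super@(_ , supermodular) X (A ∷ L) (A#L ∷ L-disjoint) (A-meets ∷ L-meets) = begin
    (l A + ΣL) + l X                              ≈⟨ +-assoc (l A) ΣL (l X) ⟩
    l A + (ΣL + l X)                              ≤⟨ +-mono-≤ ≤-refl (supermodular-uncross l-super X L L-disjoint L-meets) ⟩
    l A + (ΣL∩X + l (X ∪ U))                      ≈⟨ x∙yz≈xz∙y (l A) ΣL∩X (l (X ∪ U)) ⟩
    (l A + l (X ∪ U)) + ΣL∩X                      ≤⟨ +-monoˡ-≤ ΣL∩X (supermodular A (X ∪ U) A∩[X∪U]-nonempty) ⟩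
    (l (A ∩ (X ∪ U)) + l (A ∪ (X ∪ U))) + ΣL∩X    ≡⟨ cong₂ (λ S T → (l S + l T) + ΣL∩X) A∩[X∪U]≡A∩X (∪-leftComm A X U) ⟩
    (l (A ∩ X) + l (X ∪ (A ∪ U))) + ΣL∩X          ≈⟨ xy∙z≈xz∙y (l (A ∩ X)) (l (X ∪ (A ∪ U))) ΣL∩X ⟩
    (l (A ∩ X) + ΣL∩X) + l (X ∪ (A ∪ U))          ∎
    where
    U : Subset _
    U = ⋃ L
    ΣL ΣL∩X : Carrier
    ΣL = sumOver R l L
    ΣL∩X = sumOver R l (map (_∩ X) L)
    A∩[X∪U]≡A∩X : A ∩ (X ∪ U) ≡ A ∩ X
    A∩[X∪U]≡A∩X = disjoint⇒∩-∪-absorb X (disjoint-⋃ L A#L)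
    A∩[X∪U]-nonempty : Nonempty (A ∩ (X ∪ U))
    A∩[X∪U]-nonempty = subst Nonempty (sym A∩[X∪U]≡A∩X) A-meets

  -- The sum of the four hypotheses, once a, b, w, m and Sₓ cancel.
  +-combine-≤ : ∀ {S₁ S₂ Sₓ a b w m u eX eY} →
    (S₁ + a) ≤ (Sₓ + w) → (w + b) ≤ (m + u) → (Sₓ - a) ≤ eX → ((m + S₂) - b) ≤ eY →
    ((S₁ + S₂) - u) ≤ (eX + eY)
  +-combine-≤ {S₁} {S₂} {Sₓ} {a} {b} {w} {m} {u} {eX} {eY} ≤₁ ≤₂ ≤₃ ≤₄ =
    x≤z+y⇒x-y≤z (+-cancelʳ-≤ K (begin
      (S₁ + S₂) + K                                  ≈⟨ regroupˡ S₁ S₂ Sₓ a b w m ⟩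
      (Sₓ + (m + S₂)) + ((S₁ + a) + (w + b))         ≤⟨ +-mono-≤ (+-mono-≤ (x-y≤z⇒x≤z+y ≤₃) (x-y≤z⇒x≤z+y ≤₄)) (+-mono-≤ ≤₁ ≤₂) ⟩
      ((eX + a) + (eY + b)) + ((Sₓ + w) + (m + u))   ≈⟨ regroupʳ Sₓ a b w m u eX eY ⟩
      ((eX + eY) + u) + K                            ∎))
    where
    K : Carrier
    K = (((Sₓ + m) + a) + w) + b
    regroupˡ : ∀ S₁ S₂ Sₓ a b w m →
      (S₁ + S₂) + ((((Sₓ + m) + a) + w) + b) ≈ (Sₓ + (m + S₂)) + ((S₁ + a) + (w + b))
    regroupˡ = solve-∀ acr
    regroupʳ : ∀ Sₓ a b w m u eX eY →
      ((eX + a) + (eY + b)) + ((Sₓ + w) + (m + u)) ≈ ((eX + eY) + u) + ((((Sₓ + m) + a) + w) + b)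
    regroupʳ = solve-∀ acr

mainTheorem14 : ∀ {c ℓ₁ ℓ₂ : Level} (R : OrderedCommutativeRing c ℓ₁ ℓ₂) {n : ℕ}
    (G : Graph n) (X Y : Subset n) (l : Subset n → OrderedCommutativeRing.Carrier R) →
    IntersectingSupermodular R l →
    PartitionConnected R G l X → PartitionConnected R G l Y →
    Nonempty (X ∩ Y) →
    PartitionConnected R G l (X ∪ Y)
mainTheorem14 R G X Y l l-super@(_ , supermodular) X-connected Y-connected X∩Y≢∅ P P-part@(_ , P-disjoint , _) = begin
  sumOver R l P - l (X ∪ Y)
    ≈⟨ +-cong (sumOver-filter (meets? X) l P) ≈-refl ⟩
  (sumOver R l P₁ + sumOver R l P₂) - l (X ∪ Y)
    ≤⟨ +-combine-≤ uncross supermodularWY (X-connected (restrict X P) (restrict-isPartition (p⊆p∪q Y) P-part))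
                                          (Y-connected (fuse X Y P) Q-part) ⟩
  fromℕ R (crossingEdges G X (restrict X P)) + fromℕ R (crossingEdges G Y (fuse X Y P))
    ≈⟨ ≈-sym (fromℕ-+ (crossingEdges G X (restrict X P)) (crossingEdges G Y (fuse X Y P))) ⟩
  fromℕ R (crossingEdges G X (restrict X P) ℕ.+ crossingEdges G Y (fuse X Y P))
    ≤⟨ fromℕ-mono-≤ (crossingEdges-+-≤ G (restrict-crosses (p⊆p∪q Y)) fuse-crosses (restrict-fuse-¬crosses {P = P})) ⟩
  fromℕ R (crossingEdges G (X ∪ Y) P) ∎
  where
  open OrderedCommutativeRing R using (_+_; _-_; _≤_; +-cong) renaming (refl to ≈-refl; sym to ≈-sym)
  open OrderedCommutativeRingProperties R
  open PosetReasoning poset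
  P₁ P₂ : List (Subset _)
  P₁ = filter (meets? X) P
  P₂ = filter (avoids? X) P
  Q-part : IsPartition Y (fuse X Y P)
  Q-part = fuse-isPartition X∩Y≢∅ P-part
  uncross : (sumOver R l P₁ + l X) ≤ (sumOver R l (restrict X P) + l (merged X P))
  uncross = supermodular-uncross l-super X P₁ (AllPairsₚ.filter⁺ (meets? X) P-disjoint) (all-filter (meets? X) P)
  supermodularWY : (l (merged X P) + l Y) ≤ (l (merged X P ∩ Y) + l (X ∪ Y))
  supermodularWY = subst (λ Z → (l (merged X P) + l Y) ≤ (l (merged X P ∩ Y) + l Z)) (merged-∪ P-part)
    (supermodular (merged X P) Y (All.head (proj₁ Q-part)))
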